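{- Let $G$ be a graph, let $\ell\geq 1$, and let $B\subseteq V(G)$. Then $B$ is an $\ell$-edge-leaky forcing set of $G$ if and only if $B$ is an $(\ell-1)$-leaky forcing set of $G$ such that for every set $L$ of $\ell-1$ vertex leaks and every $v\in V(G)\setminus B$, there exist forces $x\rightarrow v,\ y\rightarrow v\in \mathcal{F}_L(B)$ with $y\neq x$.
   Context: All graphs are finite simple graphs. Given a graph $G$ and a set $B\subseteq V(G)$ of initially blue vertices (all other vertices white), the zero forcing color-change rule says: if a blue vertex $u$ has exactly one white neighbor $w$, then $u$ may force $w$, i.e. color $w$ blue (written $u\rightarrow w$, a force). A vertex leak is a vertex that is not allowed to perform any force. A set $B$ is an $\ell$-leaky forcing set of $G$ if for every set $L\subseteq V(G)$ of $\ell$ vertex leaks, exhaustively applying the color-change rule from $B$ (with vertices of $L$ never forcing) turns all of $G$ blue. For a set $L$ of vertex leaks, a forcing process of $B$ with leaks $L$ is a set of forces, none performed by a vertex of $L$, admitting a chronological ordering in which every force is valid when performed and at the end all of $G$ is blue; $\mathcal{F}_L(B)$ is the set of forces $u\rightarrow v$ that belong to some such forcing process. An edge leak is an edge $xy$ of $G$ across which no force may be performed (neither $x\rightarrow y$ nor $y\rightarrow x$ is allowed). A set $B$ is an $\ell$-edge-leaky forcing set of $G$ if for every set of $\ell$ edge leaks, exhaustively applying the color-change rule from $B$ (never forcing across an edge leak) turns all of $G$ blue. -}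

module Defs where

open import Data.Nat using (ℕ)
open import Data.Fin using (Fin)
open import Data.Fin.Subset using (Subset; _∈_; _∉_)
open import Data.Product using (_×_; _,_; ∃; ∃-syntax)
open import Data.Sum using (_⊎_)
open import Data.List using (List; []; _∷_)
open import Data.Vec using (Vec)
import Data.List.Membership.Propositional as LM
import Data.Vec.Membership.Propositional as VM
open import Relation.Nullary using (¬_; Dec)
open import Relation.Binary.PropositionalEquality using (_≡_; _≢_)

record Graph (n : ℕ) : Set₁ where
  field
    Adj   : Fin n → Fin n → Set
    adj?  : ∀ u v → Dec (Adj u v)
    sym   : ∀ {u v} → Adj u v → Adj v u
    irrefl : ∀ {u} → ¬ Adj u u
open Graph public

-- Final blue set after exhaustively applying the color-change rule from B,
-- where a force u → v is only permitted when Allowed u v holds.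
-- (Least set containing B closed under forcing; this is the unique final colouring.)
data Closure {n : ℕ} (G : Graph n) (B : Subset n)
             (Allowed : Fin n → Fin n → Set) : Fin n → Set where
  initial : ∀ {v} → v ∈ B → Closure G B Allowed v
  force   : ∀ {u v} → Allowed u v → Adj G u v → Closure G B Allowed u →
            (∀ w → Adj G u w → w ≢ v → Closure G B Allowed w) →
            Closure G B Allowed v

-- A set of vertex leaks of size (at most) ℓ: a vector of ℓ vertices (repeats allowed).
VertexLeaks : ℕ → ℕ → Set
VertexLeaks n ℓ = Vec (Fin n) ℓ

-- A set of edge leaks of size (at most) ℓ: a vector of ℓ vertex pairs
-- (a pair that is not an edge of G has no effect).
EdgeLeaks : ℕ → ℕ → Set
EdgeLeaks n ℓ = Vec (Fin n × Fin n) ℓ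

VAllowed : ∀ {n ℓ} → VertexLeaks n ℓ → Fin n → Fin n → Set
VAllowed L u v = ¬ (u VM.∈ L)

EAllowed : ∀ {n ℓ} → EdgeLeaks n ℓ → Fin n → Fin n → Set
EAllowed E u v = ¬ ((u , v) VM.∈ E) × ¬ ((v , u) VM.∈ E)

LeakyForcing : ∀ {n} → Graph n → ℕ → Subset n → Set
LeakyForcing {n} G ℓ B = ∀ (L : VertexLeaks n ℓ) → ∀ v → Closure G B (VAllowed L) v

EdgeLeakyForcing : ∀ {n} → Graph n → ℕ → Subset n → Set
EdgeLeakyForcing {n} G ℓ B = ∀ (E : EdgeLeaks n ℓ) → ∀ v → Closure G B (EAllowed E) v

addBlue : ∀ {n} → (Fin n → Set) → Fin n → (Fin n → Set)
addBlue S v w = S w ⊎ w ≡ v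

ValidForce : ∀ {n ℓ} → Graph n → VertexLeaks n ℓ → (Fin n → Set) → Fin n → Fin n → Set
ValidForce G L S u v =
  ¬ (u VM.∈ L) × S u × Adj G u v × ¬ S v × (∀ w → Adj G u w → w ≢ v → S w)

data ValidSeq {n ℓ} (G : Graph n) (L : VertexLeaks n ℓ) :
              (Fin n → Set) → List (Fin n × Fin n) → Set₁ where
  done : ∀ {S} → (∀ w → S w) → ValidSeq G L S []
  step : ∀ {S u v fs} → ValidForce G L S u v → ValidSeq G L (addBlue S v) fs →
         ValidSeq G L S ((u , v) ∷ fs)

ForcingProcess : ∀ {n ℓ} → Graph n → Subset n → VertexLeaks n ℓ → List (Fin n × Fin n) → Set₁
ForcingProcess G B L fs = ValidSeq G L (λ w → w ∈ B) fs

-- u → v ∈ 𝓕_L(B): the force belongs to some forcing process of B with leaks L.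
InForces : ∀ {n ℓ} → Graph n → Subset n → VertexLeaks n ℓ → Fin n → Fin n → Set₁
InForces G B L u v = ∃[ fs ] (ForcingProcess G B L fs × (u , v) LM.∈ fs)

-- Forward: vertex leaks L are simulated by edge leaks, cutting at each leak u
-- the edge to its white neighbour in the final colouring C under L (the only
-- vertex u could ever force). So an ℓ-edge-leaky set is (ℓ-1)-leaky. If v ∉ B
-- had at most one vertex x able to force v once everything avoiding v is blue,
-- one more edge leak at xv would keep v white; and each such x is realised in a
-- forcing process by colouring everything but v first.
-- Backward: if ℓ edge leaks stop at a colouring C ≠ V(G), some leaked edge is
-- crossed by a force u₁ → v out of C. Replacing every other leaked edge by a
-- vertex leak at its escaping end gives ℓ-1 vertex leaks under which every
-- force into v in a forcing process comes from u₁, contradicting the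
-- two-forcer hypothesis.

module Submission where

open import Defs hiding (sym)
open import Data.Nat using (ℕ; suc; _≤_; _<_; _∸_; z≤n; s≤s)
open import Data.Nat.Properties using (≤-refl; <-≤-trans; ∸-monoʳ-<)
open import Data.Fin using (Fin)
open import Data.Fin.Properties using (_≟_; any?; all?)
open import Data.Fin.Subset using (Subset; _∈_; _∉_; _∪_; ⁅_⁆; ∣_∣)
open import Data.Fin.Subset.Properties
  using (_∈?_; p⊆p∪q; x∈p∪q⁺; x∈p∪q⁻; x∈⁅x⁆; x∈⁅y⁆⇒x≡y; p⊂q⇒∣p∣<∣q∣; ∣p∣≤n)
open import Data.Product using (_×_; _,_; proj₁; proj₂; ∃-syntax)
open import Data.Product.Properties using (≡-dec)
open import Data.Sum using (_⊎_; inj₁; inj₂)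
import Data.Sum as Sum
open import Data.List using (List; []; _∷_; _++_)
import Data.List.Membership.Propositional as LM
open import Data.List.Membership.Propositional.Properties using (∈-++⁺ʳ)
import Data.List.Relation.Unary.Any as LAny
open import Data.Vec as Vec using (Vec; lookup; map; removeAt; replicate)
open import Data.Vec.Properties using (removeAt-punchOut)
import Data.Vec.Relation.Unary.Any as Any
open import Data.Vec.Relation.Unary.Any.Properties using (lookup-index)
import Data.Vec.Membership.Propositional as VM
open import Data.Vec.Membership.Propositional.Properties using (∈-lookup; ∈-map⁺)
import Data.Vec.Membership.DecPropositional as DecVM
open import Data.Empty using (⊥; ⊥-elim)
open import Function using (id)
open import Function.Bundles using (_⇔_; mk⇔)
open import Relation.Nullary using (¬_; Dec; yes; no)
open import Relation.Nullary.Decidable using (_×-dec_; _→-dec_; ¬?)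
open import Relation.Unary using (_⊆_; _≐_; Decidable)
open import Relation.Binary.PropositionalEquality
  using (_≡_; _≢_; refl; sym; trans; cong; subst)

x∉p⇒n∸∣p∪⁅x⁆∣<n∸∣p∣ : ∀ {n} {p : Subset n} {x} → x ∉ p → n ∸ ∣ p ∪ ⁅ x ⁆ ∣ < n ∸ ∣ p ∣
x∉p⇒n∸∣p∪⁅x⁆∣<n∸∣p∣ {p = p} {x} x∉p =
  ∸-monoʳ-< (p⊂q⇒∣p∣<∣q∣ (p⊆p∪q {p = p} ⁅ x ⁆ , x , x∈p∪q⁺ (inj₂ (x∈⁅x⁆ x)) , x∉p))
    (∣p∣≤n (p ∪ ⁅ x ⁆))

lookup∈removeAt : ∀ {A : Set} {k} (xs : Vec A (suc k)) {i j} → i ≢ j →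
  lookup xs j VM.∈ removeAt xs i
lookup∈removeAt xs {i} i≢j =
  subst (VM._∈ removeAt xs i) (removeAt-punchOut xs i≢j) (∈-lookup _ (removeAt xs i))

twoWitnesses : ∀ {n} {P : Fin n → Set} → Fin n → Decidable P →
  (∀ x → ¬ P ⊆ (_≡ x)) → ∃[ x ] ∃[ y ] (y ≢ x × P x × P y)
twoWitnesses {P = P} x₀ P? notSingleton with any? P?
... | no none = ⊥-elim (notSingleton x₀ (λ Px → ⊥-elim (none (_ , Px))))
... | yes (x , Px) with any? (λ y → P? y ×-dec ¬? (y ≟ x))
...   | yes (y , Py , y≢x) = x , y , y≢x , Px , Py
...   | no noOther = ⊥-elim (notSingleton x onlyX)
  where
  onlyX : P ⊆ (_≡ x)
  onlyX {y} Py with y ≟ x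
  ... | yes y≡x = y≡x
  ... | no y≢x = ⊥-elim (noOther (y , Py , y≢x))

module _ {n : ℕ} (G : Graph n) where

  CanForce : (Fin n → Set) → Fin n → Fin n → Set
  CanForce S u w = S u × Adj G u w × ¬ S w × (∀ z → Adj G u z → z ≢ w → S z)

  ForceClosed : (Fin n → Fin n → Set) → (Fin n → Set) → Set
  ForceClosed A S =
    ∀ {u w} → A u w → Adj G u w → S u → (∀ z → Adj G u z → z ≢ w → S z) → S w

  canForce? : {S : Fin n → Set} → Decidable S → ∀ u w → Dec (CanForce S u w)
  canForce? S? u w = S? u ×-dec adj? G u w ×-dec ¬? (S? w) ×-dec
    all? (λ z → adj? G u z →-dec (¬? (z ≟ w) →-dec S? z))

  CanForce-mono : ∀ {S T u w} → S ⊆ T → ¬ T w → CanForce S u w → CanForce T u w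
  CanForce-mono S⊆T ¬Tw (Su , adj , _ , others) =
    S⊆T Su , adj , ¬Tw , λ z adj-z z≢w → S⊆T (others z adj-z z≢w)

  noEscape⇒forceClosed : ∀ {A S} → Decidable S →
    (∀ {u w} → A u w → ¬ CanForce S u w) → ForceClosed A S
  noEscape⇒forceClosed S? noEscape {w = w} a adj Su others with S? w
  ... | yes Sw = Sw
  ... | no ¬Sw = ⊥-elim (noEscape a (Su , adj , ¬Sw , others))

  module _ (B : Subset n) {A : Fin n → Fin n → Set} where

    closure-least : ∀ {S} → (_∈ B) ⊆ S → ForceClosed A S → Closure G B A ⊆ S
    closure-least B⊆S closed (initial v∈B) = B⊆S v∈B
    closure-least B⊆S closed (force a adj Cu others) =
      closed a adj (closure-least B⊆S closed Cu)
        (λ z adj-z z≢w → closure-least B⊆S closed (others z adj-z z≢w))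

    closure-stuck : ∀ {u w} → A u w → ¬ CanForce (Closure G B A) u w
    closure-stuck a (Cu , adj , ¬Cw , others) = ¬Cw (force a adj Cu others)

  data Run (A : Fin n → Fin n → Set) :
           Subset n → List (Fin n × Fin n) → Subset n → Set where
    []   : ∀ {p} → Run A p [] p
    step : ∀ {p u w fs q} → A u w → CanForce (_∈ p) u w →
           Run A (p ∪ ⁅ w ⁆) fs q → Run A p ((u , w) ∷ fs) q

  module _ (B : Subset n) {A : Fin n → Fin n → Set}
           (A? : ∀ u w → Dec (A u w)) where

    saturate : (p : Subset n) → (_∈ B) ⊆ (_∈ p) → (_∈ p) ⊆ Closure G B A →
      ∃[ fs ] ∃[ q ] (Run A p fs q × (_∈ q) ≐ Closure G B A)
    saturate p = saturate-within (n ∸ ∣ p ∣) p ≤-refl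
      where
      saturate-within : (k : ℕ) (p : Subset n) → n ∸ ∣ p ∣ ≤ k →
        (_∈ B) ⊆ (_∈ p) → (_∈ p) ⊆ Closure G B A →
        ∃[ fs ] ∃[ q ] (Run A p fs q × (_∈ q) ≐ Closure G B A)
      saturate-within k p bound B⊆p p⊆C
        with any? (λ u → any? (λ w → A? u w ×-dec canForce? (_∈? p) u w))
      ... | no stuck =
        [] , p , [] , p⊆C ,
        closure-least B B⊆p
          (noEscape⇒forceClosed (_∈? p) (λ a esc → stuck (_ , _ , a , esc)))
      ... | yes (u , w , a , esc@(Su , adj , w∉p , others)) =
        extend k (<-≤-trans (x∉p⇒n∸∣p∪⁅x⁆∣<n∸∣p∣ w∉p) bound)
        where
        p′⊆C : (_∈ p ∪ ⁅ w ⁆) ⊆ Closure G B A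
        p′⊆C z∈p′ with x∈p∪q⁻ p ⁅ w ⁆ z∈p′
        ... | inj₁ z∈p = p⊆C z∈p
        ... | inj₂ z∈⁅w⁆ rewrite x∈⁅y⁆⇒x≡y w z∈⁅w⁆ =
          force a adj (p⊆C Su) (λ z adj-z z≢w → p⊆C (others z adj-z z≢w))

        extend : (k : ℕ) → suc (n ∸ ∣ p ∪ ⁅ w ⁆ ∣) ≤ k →
          ∃[ fs ] ∃[ q ] (Run A p fs q × (_∈ q) ≐ Closure G B A)
        extend (suc k) (s≤s bound′)
          with saturate-within k (p ∪ ⁅ w ⁆) bound′
                 (λ z∈B → p⊆p∪q {p = p} ⁅ w ⁆ (B⊆p z∈B)) p′⊆C
        ... | fs , q , run , q≐C = (u , w) ∷ fs , q , step a esc run , q≐C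

    closure? : Decidable (Closure G B A)
    closure? z with saturate B id initial
    ... | _ , q , _ , q⊆C , C⊆q with z ∈? q
    ...   | yes z∈q = yes (q⊆C z∈q)
    ...   | no z∉q = no (λ Cz → z∉q (C⊆q Cz))

  ValidSeq-resp : ∀ {ℓ} {L : VertexLeaks n ℓ} {S T fs} →
    S ≐ T → ValidSeq G L S fs → ValidSeq G L T fs
  ValidSeq-resp (S⊆T , T⊆S) (done all) = done (λ w → S⊆T (all w))
  ValidSeq-resp (S⊆T , T⊆S) (step (u∉L , esc@(_ , _ , ¬Sv , _)) seq) =
    step (u∉L , CanForce-mono S⊆T (λ Tv → ¬Sv (T⊆S Tv)) esc)
      (ValidSeq-resp (Sum.map S⊆T id , Sum.map T⊆S id) seq)

  ∪⁅⁆≐addBlue : ∀ (p : Subset n) x → (_∈ p ∪ ⁅ x ⁆) ≐ addBlue (_∈ p) x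
  ∪⁅⁆≐addBlue p x =
    (λ z∈p′ → Sum.map id (x∈⁅y⁆⇒x≡y x) (x∈p∪q⁻ p ⁅ x ⁆ z∈p′)) ,
    (λ { (inj₁ z∈p) → x∈p∪q⁺ (inj₁ z∈p) ; (inj₂ refl) → x∈p∪q⁺ (inj₂ (x∈⁅x⁆ x)) })

  run-++ : ∀ {ℓ} {L : VertexLeaks n ℓ} {A p fs q gs} →
    (∀ {u w} → A u w → VAllowed L u w) →
    Run A p fs q → ValidSeq G L (_∈ q) gs → ValidSeq G L (_∈ p) (fs ++ gs)
  run-++ allowed [] seq = seq
  run-++ {p = p} allowed (step {w = w} a esc run) seq =
    step (allowed a , esc) (ValidSeq-resp (∪⁅⁆≐addBlue p w) (run-++ allowed run seq))

  forced⇒white : ∀ {ℓ} {L : VertexLeaks n ℓ} {S fs x v} →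
    ValidSeq G L S fs → (x , v) LM.∈ fs → ¬ S v
  forced⇒white (step (_ , _ , _ , ¬Sv , _) _) (LAny.here refl) = ¬Sv
  forced⇒white (step _ seq) (LAny.there x,v∈fs) Sv =
    forced⇒white seq x,v∈fs (inj₁ Sv)

  VAllowedAvoiding : ∀ {ℓ} → VertexLeaks n ℓ → Fin n → Fin n → Fin n → Set
  VAllowedAvoiding L v u w = VAllowed L u w × w ≢ v

  -- Every force performed before the first force into v stays inside C, so
  -- that force is already valid from C.
  forceInto-valid : ∀ {ℓ} {L : VertexLeaks n ℓ} {v C S fs x} →
    ForceClosed (VAllowedAvoiding L v) C → ¬ C v →
    ValidSeq G L S fs → S ⊆ C → (x , v) LM.∈ fs → ValidForce G L C x v
  forceInto-valid closed ¬Cv (step (x∉L , esc) _) S⊆C (LAny.here refl) =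
    x∉L , CanForce-mono S⊆C ¬Cv esc
  forceInto-valid {v = v} {C} {S} closed ¬Cv
    (step {u = u} {v = w} (u∉L , Su , adj , _ , others) seq) S⊆C (LAny.there x,v∈fs)
    with w ≟ v
  ... | yes refl = ⊥-elim (forced⇒white seq x,v∈fs (inj₂ refl))
  ... | no w≢v = forceInto-valid closed ¬Cv seq S′⊆C x,v∈fs
    where
    S′⊆C : addBlue S w ⊆ C
    S′⊆C (inj₁ Sz) = S⊆C Sz
    S′⊆C (inj₂ refl) =
      closed (u∉L , w≢v) adj (S⊆C Su) (λ z adj-z z≢w → S⊆C (others z adj-z z≢w))

  inForces⇒validForce : ∀ {ℓ} {L : VertexLeaks n ℓ} {B v C x} →
    ForceClosed (VAllowedAvoiding L v) C → (_∈ B) ⊆ C → ¬ C v →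
    InForces G B L x v → ValidForce G L C x v
  inForces⇒validForce closed B⊆C ¬Cv (_ , process , x,v∈fs) =
    forceInto-valid closed ¬Cv process B⊆C x,v∈fs

  open DecVM (_≟_ {n}) using () renaming (_∈?_ to _∈ⱽ?_)
  open DecVM (≡-dec (_≟_ {n}) (_≟_ {n})) using () renaming (_∈?_ to _∈ᴱ?_)

  VAllowed? : ∀ {ℓ} (L : VertexLeaks n ℓ) u w → Dec (VAllowed L u w)
  VAllowed? L u w = ¬? (u ∈ⱽ? L)

  VAllowedAvoiding? : ∀ {ℓ} (L : VertexLeaks n ℓ) v u w →
    Dec (VAllowedAvoiding L v u w)
  VAllowedAvoiding? L v u w = VAllowed? L u w ×-dec ¬? (w ≟ v)

  EAllowed? : ∀ {ℓ} (E : EdgeLeaks n ℓ) u w → Dec (EAllowed E u w)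
  EAllowed? E u w = ¬? ((u , w) ∈ᴱ? E) ×-dec ¬? ((w , u) ∈ᴱ? E)

  module _ {C : Fin n → Set} (C? : Decidable C) where

    whiteNeighbour : Fin n → Fin n
    whiteNeighbour u with any? (λ z → adj? G u z ×-dec ¬? (C? z))
    ... | yes (z , _) = z
    ... | no _ = u

    whiteNeighbour-unique : ∀ {u w} → CanForce C u w → whiteNeighbour u ≡ w
    whiteNeighbour-unique {u} {w} (_ , adj , ¬Cw , others)
      with any? (λ z → adj? G u z ×-dec ¬? (C? z))
    ... | no none = ⊥-elim (none (w , adj , ¬Cw))
    ... | yes (z , adj-z , ¬Cz) with z ≟ w
    ...   | yes z≡w = z≡w
    ...   | no z≢w = ⊥-elim (¬Cz (others z adj-z z≢w))

    leakEdges : ∀ {ℓ} → VertexLeaks n ℓ → EdgeLeaks n ℓ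
    leakEdges = map (λ u → u , whiteNeighbour u)

    leakEdges-cover : ∀ {ℓ} {L : VertexLeaks n ℓ} {u w} →
      u VM.∈ L → CanForce C u w → (u , w) VM.∈ leakEdges L
    leakEdges-cover u∈L esc =
      subst (λ t → (_ , t) VM.∈ leakEdges _) (whiteNeighbour-unique esc)
        (∈-map⁺ (λ u → u , whiteNeighbour u) u∈L)

    blockedEscapes⇒closure⊆ : ∀ {B ℓ} {E : EdgeLeaks n ℓ} → (_∈ B) ⊆ C →
      (∀ {u w} → CanForce C u w → (u , w) VM.∈ E) → Closure G B (EAllowed E) ⊆ C
    blockedEscapes⇒closure⊆ {B} {E = E} B⊆C blocked =
      closure-least B {EAllowed E} B⊆C
        (noEscape⇒forceClosed {EAllowed E} C?
          (λ (u,w∉E , _) esc → u,w∉E (blocked esc)))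

  module _ (B : Subset n) {m : ℕ} (edgeLeaky : EdgeLeakyForcing G (suc m) B) where

    edgeLeaky⇒leaky : LeakyForcing G m B
    edgeLeaky⇒leaky L z = blockedEscapes⇒closure⊆ C? initial blocked (edgeLeaky E z)
      where
      C? : Decidable (Closure G B (VAllowed L))
      C? = closure? B (VAllowed? L)
      -- (z , z) is not an edge; it only pads E to length m + 1.
      E : EdgeLeaks n (suc m)
      E = (z , z) Vec.∷ leakEdges C? L
      blocked : ∀ {u w} → CanForce (Closure G B (VAllowed L)) u w → (u , w) VM.∈ E
      blocked {u} esc with u ∈ⱽ? L
      ... | yes u∈L = Any.there (leakEdges-cover C? u∈L esc)
      ... | no u∉L = ⊥-elim (closure-stuck B u∉L esc)

    module _ (L : VertexLeaks n m) (v : Fin n) (v∉B : v ∉ B) where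
      private
        C : Fin n → Set
        C = Closure G B (VAllowedAvoiding L v)
        C? : Decidable C
        C? = closure? B (VAllowedAvoiding? L v)

        ¬Cv : ¬ C v
        ¬Cv Cv = closure-least B (λ { z∈B refl → v∉B z∈B }) (λ a _ _ _ → proj₂ a) Cv refl

      forcers-notSingleton : ∀ x₀ → ¬ (λ x → ValidForce G L C x v) ⊆ (_≡ x₀)
      forcers-notSingleton x₀ onlyX₀ =
        ¬Cv (blockedEscapes⇒closure⊆ C? initial blocked (edgeLeaky E v))
        where
        E : EdgeLeaks n (suc m)
        E = (x₀ , v) Vec.∷ leakEdges C? L
        blocked : ∀ {u w} → CanForce C u w → (u , w) VM.∈ E
        blocked {u} {w} esc with u ∈ⱽ? L | w ≟ v
        ... | yes u∈L | _ = Any.there (leakEdges-cover C? u∈L esc)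
        ... | no u∉L | no w≢v = ⊥-elim (closure-stuck B (u∉L , w≢v) esc)
        ... | no u∉L | yes refl = Any.here (cong (_, v) (onlyX₀ (u∉L , esc)))

      forcer⇒inForces : ∀ {x} → ValidForce G L C x v → InForces G B L x v
      forcer⇒inForces {x} (x∉L , esc)
        with saturate B (VAllowedAvoiding? L v) B id initial
      ... | fs₁ , q₁ , run₁ , q₁⊆C , C⊆q₁
        with saturate B (VAllowed? L) (q₁ ∪ ⁅ v ⁆)
               (λ z∈B → p⊆p∪q {p = q₁} ⁅ v ⁆ (C⊆q₁ (initial z∈B)))
               (λ _ → edgeLeaky⇒leaky L _)
      ... | fs₂ , q₂ , run₂ , _ , everything⊆q₂ =
        fs₁ ++ (x , v) ∷ fs₂ ++ [] ,
        run-++ proj₁ run₁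
          (step (x∉L , CanForce-mono C⊆q₁ (λ v∈q₁ → ¬Cv (q₁⊆C v∈q₁)) esc)
            (ValidSeq-resp (∪⁅⁆≐addBlue q₁ v)
              (run-++ id run₂ (done (λ w → everything⊆q₂ (edgeLeaky⇒leaky L w)))))) ,
        ∈-++⁺ʳ fs₁ (LAny.here refl)

      edgeLeaky⇒twoForcers :
        ∃[ x ] ∃[ y ] (y ≢ x × InForces G B L x v × InForces G B L y v)
      edgeLeaky⇒twoForcers
        with twoWitnesses v (λ x → VAllowed? L x v ×-dec canForce? C? x v)
               forcers-notSingleton
      ... | x , y , y≢x , x-forces , y-forces =
        x , y , y≢x , forcer⇒inForces x-forces , forcer⇒inForces y-forces

  Across : Fin n × Fin n → Fin n → Fin n → Set
  Across e u w = e ≡ (u , w) ⊎ e ≡ (w , u)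

  across-escape-unique : ∀ {C : Fin n → Set} {e u w u′ w′} →
    Across e u w → Across e u′ w′ → C u → ¬ C w → C u′ → ¬ C w′ → u ≡ u′ × w ≡ w′
  across-escape-unique (inj₁ refl) (inj₁ refl) _ _ _ _ = refl , refl
  across-escape-unique (inj₂ refl) (inj₂ refl) _ _ _ _ = refl , refl
  across-escape-unique (inj₁ refl) (inj₂ refl) Cu _ _ ¬Cw′ = ⊥-elim (¬Cw′ Cu)
  across-escape-unique (inj₂ refl) (inj₁ refl) Cu _ _ ¬Cw′ = ⊥-elim (¬Cw′ Cu)

  module _ {C : Fin n → Set} (C? : Decidable C) where

    escapingEnd : Fin n × Fin n → Fin n
    escapingEnd (a , b) with canForce? C? a b
    ... | yes _ = a
    ... | no _ = b

    escapingEnd-escape : ∀ {e u w} → CanForce C u w → Across e u w → escapingEnd e ≡ u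
    escapingEnd-escape {u = u} {w} esc (inj₁ refl) with canForce? C? u w
    ... | yes _ = refl
    ... | no ¬esc = ⊥-elim (¬esc esc)
    escapingEnd-escape {u = u} {w} (_ , _ , ¬Cw , _) (inj₂ refl) with canForce? C? w u
    ... | yes (Cw , _) = ⊥-elim (¬Cw Cw)
    ... | no _ = refl

  module _ (B : Subset n) {m : ℕ} (leaky : LeakyForcing G m B)
    (twoForcers : ∀ (L : VertexLeaks n m) (v : Fin n) → v ∉ B →
      ∃[ x ] ∃[ y ] (y ≢ x × InForces G B L x v × InForces G B L y v))
    (E : EdgeLeaks n (suc m)) where
    private
      C : Fin n → Set
      C = Closure G B (EAllowed E)
      C? : Decidable C
      C? = closure? B (EAllowed? E)

    escape⇒leakEdge : ∀ {u w} → CanForce C u w → ∃[ j ] Across (lookup E j) u w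
    escape⇒leakEdge {u} {w} esc with (u , w) ∈ᴱ? E | (w , u) ∈ᴱ? E
    ... | yes u,w∈E | _ = Any.index u,w∈E , inj₁ (sym (lookup-index u,w∈E))
    ... | no _ | yes w,u∈E = Any.index w,u∈E , inj₂ (sym (lookup-index w,u∈E))
    ... | no u,w∉E | no w,u∉E = ⊥-elim (closure-stuck B (u,w∉E , w,u∉E) esc)

    module _ (i : Fin (suc m)) {u₁ v : Fin n} (esc₁ : CanForce C u₁ v)
             (across₁ : Across (lookup E i) u₁ v) where
      private
        L : VertexLeaks n m
        L = map (escapingEnd C?) (removeAt E i)
        Cu₁ : C u₁
        Cu₁ = proj₁ esc₁
        ¬Cv : ¬ C v
        ¬Cv = proj₁ (proj₂ (proj₂ esc₁))

      otherEscape-leaks : ∀ {j u w} →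
        i ≢ j → CanForce C u w → Across (lookup E j) u w → u VM.∈ L
      otherEscape-leaks i≢j esc across =
        subst (VM._∈ L) (escapingEnd-escape C? esc across)
          (∈-map⁺ (escapingEnd C?) (lookup∈removeAt E i≢j))

      C-avoidingClosed : ForceClosed (VAllowedAvoiding L v) C
      C-avoidingClosed = noEscape⇒forceClosed C? noEscape
        where
        noEscape : ∀ {u w} → VAllowedAvoiding L v u w → ¬ CanForce C u w
        noEscape (u∉L , w≢v) esc@(Cu , _ , ¬Cw , _) with escape⇒leakEdge esc
        ... | j , across with i ≟ j
        ...   | yes refl =
          w≢v (proj₂ (across-escape-unique across across₁ Cu ¬Cw Cu₁ ¬Cv))
        ...   | no i≢j = u∉L (otherEscape-leaks i≢j esc across)

      forcer-unique : ∀ {x} → InForces G B L x v → x ≡ u₁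
      forcer-unique forces with inForces⇒validForce C-avoidingClosed initial ¬Cv forces
      ... | x∉L , esc@(Cx , _ , _ , _) with escape⇒leakEdge esc
      ...   | j , across with i ≟ j
      ...     | yes refl = proj₁ (across-escape-unique across across₁ Cx ¬Cv Cu₁ ¬Cv)
      ...     | no i≢j = ⊥-elim (x∉L (otherEscape-leaks i≢j esc across))

      escape-impossible : ⊥
      escape-impossible with twoForcers L v (λ v∈B → ¬Cv (initial v∈B))
      ... | x , y , y≢x , x-forces , y-forces =
        y≢x (trans (forcer-unique y-forces) (sym (forcer-unique x-forces)))

    twoForcers⇒edgeLeaky : ∀ z → C z
    twoForcers⇒edgeLeaky z with any? (λ u → any? (λ w → canForce? C? u w))
    ... | yes (_ , _ , esc) with escape⇒leakEdge esc
    ...   | i , across = ⊥-elim (escape-impossible i esc across)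
    twoForcers⇒edgeLeaky z | no none =
      closure-least B {VAllowed L₀} initial
        (noEscape⇒forceClosed {VAllowed L₀} C? (λ _ esc → none (_ , _ , esc)))
        (leaky L₀ z)
      where
      L₀ : VertexLeaks n m
      L₀ = replicate m z

theorem2p3 : ∀ {n : ℕ} (G : Graph n) (ℓ : ℕ) → 1 ≤ ℓ → (B : Subset n) →
    EdgeLeakyForcing G ℓ B ⇔
      (LeakyForcing G (ℓ ∸ 1) B ×
        (∀ (L : VertexLeaks n (ℓ ∸ 1)) (v : Fin n) → v ∉ B →
          ∃[ x ] ∃[ y ] (y ≢ x × InForces G B L x v × InForces G B L y v)))
theorem2p3 G (suc m) (s≤s z≤n) B = mk⇔
  (λ edgeLeaky → edgeLeaky⇒leaky G B edgeLeaky , edgeLeaky⇒twoForcers G B edgeLeaky)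
  (λ (leaky , twoForcers) → twoForcers⇒edgeLeaky G B leaky twoForcers)
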